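{- Let $p$ be a prime, $R\ge1$, $V=\mathbb{F}_{p^R}$, and let $k\ge2$ divide $p^R-1$ with $\frac{p^R-1}{k}$ even if $p$ is odd. Let $\Gamma=\mathrm{GPaley}(p^R,\frac{p^R-1}{k})=\mathrm{Cay}(V,S)$ be a connected generalised Paley graph. Then for a divisor $a$ of $R$ with $1\le a<R$, $\Gamma$ is isomorphic to the Hamming graph $H(p^a,\frac{R}{a})$ if and only if $k=\frac{a(p^R-1)}{R(p^a-1)}$.
   Context: For $V=\mathbb{F}_q$ ($q=p^R$), $k\ge2$ with $k\mid q-1$ and $\frac{q-1}{k}$ even if $p$ is odd, and a fixed primitive element $\omega$ of $\mathbb{F}_q$, the generalised Paley graph $\mathrm{GPaley}(q,\frac{q-1}{k})$ is the Cayley graph $\mathrm{Cay}(V,S)$ with $S=\{\omega^{jk}: j\ge0\}$: vertex set $V$, and $\{u,v\}$ is an edge iff $v-u\in S$. The Hamming graph $H(a,b)$ ($b>1$) has as vertices the $b$-tuples with entries from a set of size $a$, two vertices being adjacent iff they differ in exactly one coordinate. -}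

module Defs where

open import Level using (0ℓ)
open import Data.Nat as ℕ using (ℕ; zero; suc)
open import Data.Fin using (Fin)
open import Data.Vec using (Vec; lookup)
open import Data.Product using (Σ; ∃; ∃-syntax; _×_; _,_)
open import Relation.Binary.PropositionalEquality using (_≡_)
open import Relation.Nullary using (¬_)
open import Function.Bundles using (Bijection)
open import Algebra.Structures using (IsCommutativeRing)

-- A (finite) field whose elements are Fin q, with propositional equality.
-- Since all fields of order q are isomorphic, quantifying over all such
-- structures captures "the" field F_q.
record FiniteField (q : ℕ) : Set where
  field
    _+_ _*_ : Fin q → Fin q → Fin q
    -_      : Fin q → Fin q
    0# 1#   : Fin q
    isCommutativeRing : IsCommutativeRing _≡_ _+_ _*_ -_ 0# 1#
    0≢1     : ¬ (0# ≡ 1#)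
    inverse : ∀ x → ¬ (x ≡ 0#) → ∃[ y ] (x * y ≡ 1#)

  infixl 7 _*_
  infixl 6 _+_ _-_

  _-_ : Fin q → Fin q → Fin q
  x - y = x + (- y)

  _^_ : Fin q → ℕ → Fin q
  x ^ zero  = 1#
  x ^ suc n = x * (x ^ n)

  IsPrimitive : Fin q → Set
  IsPrimitive ω = ∀ x → ¬ (x ≡ 0#) → ∃[ j ] (x ≡ ω ^ j)

module _ {q : ℕ} (F : FiniteField q) where
  open FiniteField F

  GPaleyS : (ω : Fin q) (k : ℕ) → Fin q → Set
  GPaleyS ω k x = ∃[ j ] (x ≡ ω ^ (j ℕ.* k))

  GPaleyAdj : (ω : Fin q) (k : ℕ) → Fin q → Fin q → Set
  GPaleyAdj ω k u v = GPaleyS ω k (v - u)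

data Reachable {V : Set} (Adj : V → V → Set) : V → V → Set where
  here  : ∀ {u} → Reachable Adj u u
  step  : ∀ {u v w} → Adj u v → Reachable Adj v w → Reachable Adj u w

Connected : {V : Set} → (V → V → Set) → Set
Connected {V} Adj = ∀ (u v : V) → Reachable Adj u v

HammingAdj : (a b : ℕ) → Vec (Fin a) b → Vec (Fin a) b → Set
HammingAdj a b x y =
  ∃[ i ] (¬ (lookup x i ≡ lookup y i) ×
          (∀ j → ¬ (j ≡ i) → lookup x j ≡ lookup y j))

Isomorphic : {V W : Set} → (V → V → Set) → (W → W → Set) → Set
Isomorphic {V} {W} AdjV AdjW =
  Σ (Bijection (≡-setoid V) (≡-setoid W)) λ f →
    ∀ u v → (AdjV u v → AdjW (Bijection.to f u) (Bijection.to f v)) ×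
            (AdjW (Bijection.to f u) (Bijection.to f v) → AdjV u v)
  where open import Relation.Binary.PropositionalEquality using () renaming (setoid to ≡-setoid)

module Submission where

-- Write q = p ^ R, N = q − 1, m = p ^ a and S = { ω ^ (j k) } for the connection set.
-- The neighbours of 0 in Γ are the N / k elements of S, while every vertex of H(m, b) has
-- b (m − 1) neighbours, so an isomorphism forces k b (m − 1) = N, which is the stated
-- equation because R = a b.  Conversely, suppose k b (m − 1) = N.  In characteristic p the
-- map y ↦ y ^ m is additive, so K = { y | y ^ m = y } is a subfield of order m whose nonzero
-- elements are the powers of ω ^ (k b), and S is the union of the cosets K* ω ^ (i k), i < b.
-- Hence, writing vertices as Σ e(cᵢ) ω ^ (i k) with c ∈ K ^ b, a step along S changes exactly
-- one coordinate.  Connectivity of Γ makes every vertex such a combination, and since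
-- |K ^ b| = m ^ b = q the coordinates are unique: they form an isomorphism Γ ≅ H(m, b).

open import Defs
open import Data.Nat using (ℕ; suc; _≤_)
import Data.Nat as ℕ
open import Data.Fin using (Fin)
open import Relation.Binary.PropositionalEquality using (_≡_)

module FinCounting where
  open import Data.Nat as ℕ using (ℕ; _^_)
  open import Data.Fin using (Fin; punchOut; funToFin; finToFun; cast)
  open import Data.Fin.Properties using (any?; _≟_; injective⇒≤; punchOut-injective; finToFun-funToFin; cast-involutive)
  open import Data.Nat.Properties using (<-irrefl)
  open import Data.Vec using (Vec; lookup; tabulate)
  open import Data.Vec.Properties using (tabulate∘lookup; tabulate-cong)
  open import Data.Product using (_,_; proj₁; proj₂)
  open import Function using (_∘_)
  open import Function.Definitions using (Injective; StrictlySurjective)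
  open import Relation.Nullary using (yes; no; contradiction)
  open import Relation.Binary.PropositionalEquality
  open ≡-Reasoning

  injective⇒strictlySurjective : ∀ {n} {f : Fin n → Fin n} →
    Injective _≡_ _≡_ f → StrictlySurjective _≡_ f
  injective⇒strictlySurjective {ℕ.suc n} {f} f-inj y with any? (λ x → f x ≟ y)
  ... | yes hit = hit
  ... | no miss = contradiction (injective⇒≤ {f = squeeze} squeeze-injective) (<-irrefl refl)
    where
    missing : ∀ x → y ≢ f x
    missing x y≡fx = miss (x , sym y≡fx)
    squeeze : Fin (ℕ.suc n) → Fin n
    squeeze x = punchOut (missing x)
    squeeze-injective : Injective _≡_ _≡_ squeeze
    squeeze-injective = f-inj ∘ punchOut-injective (missing _) (missing _)

  lookup-injective : ∀ {A : Set} {n} {xs ys : Vec A n} →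
    (∀ i → lookup xs i ≡ lookup ys i) → xs ≡ ys
  lookup-injective {xs = xs} {ys} eq = begin
    xs                    ≡⟨ tabulate∘lookup xs ⟨
    tabulate (lookup xs)  ≡⟨ tabulate-cong eq ⟩
    tabulate (lookup ys)  ≡⟨ tabulate∘lookup ys ⟩
    ys                    ∎

  vecToFin : ∀ {m n} → Vec (Fin m) n → Fin (m ^ n)
  vecToFin xs = funToFin (lookup xs)

  vecToFin-injective : ∀ {m n} → Injective _≡_ _≡_ (vecToFin {m} {n})
  vecToFin-injective {x = xs} {ys} eq = lookup-injective λ i → begin
    lookup xs i                        ≡⟨ finToFun-funToFin (lookup xs) i ⟨
    finToFun (vecToFin xs) i           ≡⟨ cong (λ c → finToFun c i) eq ⟩
    finToFun (vecToFin ys) i           ≡⟨ finToFun-funToFin (lookup ys) i ⟩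
    lookup ys i                        ∎

  cast-injective : ∀ {m n} (eq : m ≡ n) → Injective _≡_ _≡_ (cast eq)
  cast-injective eq {i} {j} castᵢ≡castⱼ = begin
    i                          ≡⟨ cast-involutive (sym eq) eq i ⟨
    cast (sym eq) (cast eq i)  ≡⟨ cong (cast (sym eq)) castᵢ≡castⱼ ⟩
    cast (sym eq) (cast eq j)  ≡⟨ cast-involutive (sym eq) eq j ⟩
    j                          ∎

  section-of-surjection-is-inverse : ∀ {A : Set} {n} {enc : A → Fin n} →
    Injective _≡_ _≡_ enc → (φ : A → Fin n) (sec : Fin n → A) →
    (∀ x → φ (sec x) ≡ x) → ∀ a → sec (φ a) ≡ a
  section-of-surjection-is-inverse {enc = enc} enc-inj φ sec φ∘sec a = begin
    sec (φ a)        ≡⟨ cong (sec ∘ φ) x↦a ⟨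
    sec (φ (sec x))  ≡⟨ cong sec (φ∘sec x) ⟩
    sec x            ≡⟨ x↦a ⟩
    a                ∎
    where
    enc∘sec-injective : Injective _≡_ _≡_ (enc ∘ sec)
    enc∘sec-injective {x} {y} eq = begin
      x            ≡⟨ φ∘sec x ⟨
      φ (sec x)    ≡⟨ cong φ (enc-inj eq) ⟩
      φ (sec y)    ≡⟨ φ∘sec y ⟩
      y            ∎
    x = proj₁ (injective⇒strictlySurjective enc∘sec-injective (enc a))
    x↦a : sec x ≡ a
    x↦a = enc-inj (proj₂ (injective⇒strictlySurjective enc∘sec-injective (enc a)))

module GraphDegree where
  open import Data.Nat using (ℕ; _≤_)
  open import Data.Nat.Properties using (≤-antisym)
  open import Data.Fin using (Fin)
  open import Data.Fin.Properties using (injective⇒≤)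
  open import Data.Product using (∃-syntax; _,_; proj₁; proj₂)
  open import Function using (_∘_)
  open import Function.Bundles using (Bijection)
  open import Function.Definitions using (Injective)
  open import Relation.Binary.PropositionalEquality

  record HasDegree {V : Set} (Adj : V → V → Set) (v : V) (d : ℕ) : Set where
    field
      neighbour           : Fin d → V
      neighbour-adjacent  : ∀ i → Adj v (neighbour i)
      neighbour-injective : Injective _≡_ _≡_ neighbour
      neighbour-complete  : ∀ w → Adj v w → ∃[ i ] neighbour i ≡ w

  module _ {V : Set} {Adj : V → V → Set} {v : V} where

    degree-≤ : ∀ {d e} → HasDegree Adj v d → HasDegree Adj v e → d ≤ e
    degree-≤ {d} {e} D E = injective⇒≤ {f = reindex} reindex-injective
      where
      open HasDegree
      reindex : Fin d → Fin e
      reindex i = proj₁ (neighbour-complete E _ (neighbour-adjacent D i))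
      reindex-injective : Injective _≡_ _≡_ reindex
      reindex-injective {i} {j} eq = neighbour-injective D (begin
        neighbour D i            ≡⟨ proj₂ (neighbour-complete E _ (neighbour-adjacent D i)) ⟨
        neighbour E (reindex i)  ≡⟨ cong (neighbour E) eq ⟩
        neighbour E (reindex j)  ≡⟨ proj₂ (neighbour-complete E _ (neighbour-adjacent D j)) ⟩
        neighbour D j            ∎)
        where open ≡-Reasoning

    degree-unique : ∀ {d e} → HasDegree Adj v d → HasDegree Adj v e → d ≡ e
    degree-unique D E = ≤-antisym (degree-≤ D E) (degree-≤ E D)

  isomorphic⇒hasDegree : ∀ {V W : Set} {AdjV : V → V → Set} {AdjW : W → W → Set} →
    (iso : Isomorphic AdjV AdjW) → ∀ {v d} → HasDegree AdjV v d →
    HasDegree AdjW (Bijection.to (proj₁ iso) v) d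
  isomorphic⇒hasDegree {AdjW = AdjW} (f , preserves) {v} D = record
    { neighbour           = to ∘ neighbour
    ; neighbour-adjacent  = λ i → proj₁ (preserves v (neighbour i)) (neighbour-adjacent i)
    ; neighbour-injective = neighbour-injective ∘ injective
    ; neighbour-complete  = complete
    }
    where
    open Bijection f using (to; injective; strictlySurjective)
    open HasDegree D
    complete : ∀ w → AdjW (to v) w → ∃[ i ] to (neighbour i) ≡ w
    complete w adj with strictlySurjective w
    ... | u , refl with neighbour-complete u (proj₂ (preserves v u) adj)
    ...   | i , refl = i , refl

module HammingGraph where
  open import Data.Nat using (ℕ; suc; _*_)
  open import Data.Fin using (Fin; punchIn; punchOut; combine; remQuot)
  open import Data.Fin.Properties using (_≟_; punchIn-injective; punchInᵢ≢i; punchIn-punchOut; combine-remQuot; remQuot-combine)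
  open import Data.Vec using (Vec; lookup; _[_]≔_)
  open import Data.Vec.Properties using (lookup∘update; lookup∘update′)
  open import Data.Product using (∃-syntax; _,_; proj₁; uncurry)
  open import Function using (_∘_)
  open import Relation.Nullary using (yes; no; contradiction)
  open import Relation.Binary.PropositionalEquality
  open FinCounting using (lookup-injective)
  open GraphDegree using (HasDegree)

  update-hammingAdj : ∀ {a b} (xs : Vec (Fin a) b) i {y} → lookup xs i ≢ y → HammingAdj a b xs (xs [ i ]≔ y)
  update-hammingAdj xs i xsᵢ≢y = i , differs , agrees
    where
    differs : lookup xs i ≢ lookup (xs [ i ]≔ _) i
    differs eq = xsᵢ≢y (trans eq (lookup∘update i xs _))
    agrees : ∀ j → j ≢ i → lookup xs j ≡ lookup (xs [ i ]≔ _) j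
    agrees j j≢i = sym (lookup∘update′ j≢i xs _)

  hammingAdj⇒update : ∀ {a b} {xs ys : Vec (Fin a) b} (adj : HammingAdj a b xs ys) →
    ys ≡ xs [ proj₁ adj ]≔ lookup ys (proj₁ adj)
  hammingAdj⇒update {xs = xs} {ys} (i , _ , agrees) = lookup-injective pointwise
    where
    pointwise : ∀ j → lookup ys j ≡ lookup (xs [ i ]≔ lookup ys i) j
    pointwise j with j ≟ i
    ... | yes refl = sym (lookup∘update i xs _)
    ... | no j≢i   = trans (sym (agrees j j≢i)) (sym (lookup∘update′ j≢i xs _))

  module _ {m₁ b : ℕ} (y : Vec (Fin (suc m₁)) b) where

    hammingNeighbour : Fin b → Fin m₁ → Vec (Fin (suc m₁)) b
    hammingNeighbour i t = y [ i ]≔ punchIn (lookup y i) t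

    hammingNeighbour-injective : ∀ {i t i′ t′} → hammingNeighbour i t ≡ hammingNeighbour i′ t′ → (i , t) ≡ (i′ , t′)
    hammingNeighbour-injective {i} {t} {i′} {t′} eq with i ≟ i′
    ... | yes refl = cong (i ,_) (punchIn-injective (lookup y i) t t′ (begin
      punchIn (lookup y i) t   ≡⟨ lookup∘update i y _ ⟨
      lookup (hammingNeighbour i t) i   ≡⟨ cong (λ z → lookup z i) eq ⟩
      lookup (hammingNeighbour i t′) i  ≡⟨ lookup∘update i y _ ⟩
      punchIn (lookup y i) t′  ∎))
      where open ≡-Reasoning
    ... | no i≢i′ = contradiction (begin
      punchIn (lookup y i) t   ≡⟨ lookup∘update i y _ ⟨
      lookup (hammingNeighbour i t) i   ≡⟨ cong (λ z → lookup z i) eq ⟩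
      lookup (hammingNeighbour i′ t′) i ≡⟨ lookup∘update′ i≢i′ y _ ⟩
      lookup y i               ∎) (punchInᵢ≢i (lookup y i) t)
      where open ≡-Reasoning

    hammingNeighbour-complete : ∀ w → HammingAdj (suc m₁) b y w → ∃[ i ] ∃[ t ] hammingNeighbour i t ≡ w
    hammingNeighbour-complete w adj@(i , differs , _) =
      i , punchOut differs , sym (trans (hammingAdj⇒update adj) (cong (y [ i ]≔_) (sym (punchIn-punchOut differs))))

    hamming-hasDegree : HasDegree (HammingAdj (suc m₁) b) y (b * m₁)
    hamming-hasDegree = record
      { neighbour           = uncurry hammingNeighbour ∘ remQuot {b} m₁
      ; neighbour-adjacent  = λ x → let (i , t) = remQuot {b} m₁ x in
          update-hammingAdj y i (punchInᵢ≢i (lookup y i) t ∘ sym)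
      ; neighbour-injective = λ {x} {x′} eq → begin
          x                                    ≡⟨ combine-remQuot {b} m₁ x ⟨
          uncurry combine (remQuot {b} m₁ x)       ≡⟨ cong (uncurry combine) (hammingNeighbour-injective eq) ⟩
          uncurry combine (remQuot {b} m₁ x′)      ≡⟨ combine-remQuot {b} m₁ x′ ⟩
          x′                                   ∎
      ; neighbour-complete  = λ w adj → let (i , t , eq) = hammingNeighbour-complete w adj in
          combine i t , trans (cong (uncurry hammingNeighbour) (remQuot-combine i t)) eq
      }
      where open ≡-Reasoning

module BinomialPrime where
  open import Data.Nat
  open import Data.Nat.Properties
  open import Data.Nat.Divisibility
  open import Data.Nat.DivMod using (m/n*n≡m)
  open import Data.Nat.Primality using (Prime; euclidsLemma; prime⇒nonTrivial)
  open import Data.Nat.Combinatorics using (_C_; nCk≡n!/k![n-k]!; k![n∸k]!∣n!)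
  open import Data.Sum using (inj₁; inj₂)
  open import Relation.Binary.PropositionalEquality
  open import Relation.Nullary using (¬_; contradiction)

  prime∤! : ∀ {p} → Prime p → ∀ {n} → n < p → ¬ (p ∣ n !)
  prime∤! pr {zero} _ p∣1 = nonTrivial⇒≢1 {{prime⇒nonTrivial pr}} (∣1⇒≡1 p∣1)
  prime∤! {p} pr {suc n} n<p p∣n! with euclidsLemma (suc n) (n !) pr p∣n!
  ... | inj₁ p∣1+n = <⇒≱ n<p (∣⇒≤ p∣1+n)
  ... | inj₂ p∣n! = prime∤! pr (<-trans (n<1+n n) n<p) p∣n!

  C*k!*[n∸k]!≡n! : ∀ {n k} → k ≤ n → (n C k) * (k ! * (n ∸ k) !) ≡ n !
  C*k!*[n∸k]!≡n! {n} {k} k≤n = trans (cong (_* (k ! * (n ∸ k) !)) (nCk≡n!/k![n-k]! k≤n)) (m/n*n≡m (k![n∸k]!∣n! k≤n))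
    where instance _ = k !* (n ∸ k) !≢0

  prime∣C : ∀ {p} → Prime p → ∀ {k} → 0 < k → k < p → p ∣ p C k
  prime∣C {p@(suc p-1)} pr {k} 0<k k<p
    with euclidsLemma (p C k) _ pr (subst (p ∣_) (sym (C*k!*[n∸k]!≡n! (<⇒≤ k<p))) (m∣m*n (p-1 !)))
  ... | inj₁ p∣C = p∣C
  ... | inj₂ p∣k!*[p-k]! with euclidsLemma (k !) ((p ∸ k) !) pr p∣k!*[p-k]!
  ...   | inj₁ p∣k! = contradiction p∣k! (prime∤! pr k<p)
  ...   | inj₂ p∣[p-k]! = contradiction p∣[p-k]! (prime∤! pr (∸-monoʳ-< {o = 0} 0<k (<⇒≤ k<p)))

module FieldProperties {q : ℕ} (F : FiniteField q) where
  open import Level using (0ℓ)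
  open import Data.Nat as ℕ using (ℕ; zero; suc; NonZero)
  import Data.Nat.Properties as ℕ
  open import Data.Nat.DivMod using (_%_; _/_; m≡m%n+[m/n]*n)
  open import Data.Fin using (Fin)
  open import Data.Fin.Properties using (_≟_)
  open import Data.Product using (_,_; proj₁)
  open import Function using (_∘_)
  open import Algebra.Bundles using (CommutativeRing)
  open import Relation.Nullary using (yes; no; contradiction)
  open import Relation.Binary.PropositionalEquality
  open ≡-Reasoning

  open FiniteField F public

  commutativeRing : CommutativeRing 0ℓ 0ℓ
  commutativeRing = record { isCommutativeRing = isCommutativeRing }

  open CommutativeRing commutativeRing public
    using ( +-assoc; +-comm; +-identityˡ; +-identityʳ; -‿inverseˡ; -‿inverseʳ
          ; *-assoc; *-comm; *-identityˡ; *-identityʳ; zeroˡ; zeroʳ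
          ; ring; semiring; commutativeSemiring; +-commutativeMonoid)
  open import Algebra.Properties.Ring ring public
    using (+-cancelˡ; +-cancelʳ; +-identityʳ-unique; -0#≈0#; [y-z]x≈yx-zx; x∙y⁻¹≈ε⇒x≈y)

  x+[-x+y]≡y : ∀ x y → x + (- x + y) ≡ y
  x+[-x+y]≡y x y = begin
    x + (- x + y)  ≡⟨ +-assoc x (- x) y ⟨
    (x - x) + y    ≡⟨ cong (_+ y) (-‿inverseʳ x) ⟩
    0# + y         ≡⟨ +-identityˡ y ⟩
    y              ∎

  -x+[x+y]≡y : ∀ x y → - x + (x + y) ≡ y
  -x+[x+y]≡y x y = begin
    - x + (x + y)  ≡⟨ +-assoc (- x) x y ⟨
    (- x + x) + y  ≡⟨ cong (_+ y) (-‿inverseˡ x) ⟩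
    0# + y         ≡⟨ +-identityˡ y ⟩
    y              ∎

  x+[y-x]≡y : ∀ x y → x + (y - x) ≡ y
  x+[y-x]≡y x y = trans (cong (x +_) (+-comm y (- x))) (x+[-x+y]≡y x y)

  [x+y]-x≡y : ∀ x y → (x + y) - x ≡ y
  [x+y]-x≡y x y = +-cancelˡ x _ _ (x+[y-x]≡y x (x + y))

  [x+y]-y≡x : ∀ x y → (x + y) - y ≡ x
  [x+y]-y≡x x y = begin
    (x + y) - y    ≡⟨ +-assoc x y (- y) ⟩
    x + (y - y)    ≡⟨ cong (x +_) (-‿inverseʳ y) ⟩
    x + 0#         ≡⟨ +-identityʳ x ⟩
    x              ∎

  x-0≡x : ∀ x → x - 0# ≡ x
  x-0≡x x = trans (cong (x +_) -0#≈0#) (+-identityʳ x)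

  [x+y]+z≡[z+y]+x : ∀ x y z → (x + y) + z ≡ (z + y) + x
  [x+y]+z≡[z+y]+x x y z = begin
    (x + y) + z    ≡⟨ +-comm (x + y) z ⟩
    z + (x + y)    ≡⟨ cong (z +_) (+-comm x y) ⟩
    z + (y + x)    ≡⟨ +-assoc z y x ⟨
    (z + y) + x    ∎

  w+as≡u+es⇒w-u≡[e-a]s : ∀ {w u a e s} → w + a * s ≡ u + e * s → w - u ≡ (e - a) * s
  w+as≡u+es⇒w-u≡[e-a]s {w} {u} {a} {e} {s} h = begin
    w - u                            ≡⟨ cong (_- u) ([x+y]-y≡x w (a * s)) ⟨
    ((w + a * s) - a * s) - u        ≡⟨ cong (λ t → (t - a * s) - u) h ⟩
    ((u + e * s) - a * s) - u        ≡⟨ cong (_- u) (+-assoc u (e * s) (- (a * s))) ⟩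
    (u + (e * s - a * s)) - u        ≡⟨ [x+y]-x≡y u _ ⟩
    e * s - a * s                    ≡⟨ [y-z]x≈yx-zx s e a ⟨
    (e - a) * s                      ∎

  x⁻¹*[x*y]≡y : ∀ {x} (x≢0 : x ≢ 0#) y → proj₁ (inverse x x≢0) * (x * y) ≡ y
  x⁻¹*[x*y]≡y {x} x≢0 y with inverse x x≢0
  ... | x⁻¹ , x*x⁻¹≡1 = begin
    x⁻¹ * (x * y)  ≡⟨ *-assoc x⁻¹ x y ⟨
    (x⁻¹ * x) * y  ≡⟨ cong (_* y) (trans (*-comm x⁻¹ x) x*x⁻¹≡1) ⟩
    1# * y         ≡⟨ *-identityˡ y ⟩
    y              ∎

  *-cancelˡ : ∀ {x} → x ≢ 0# → ∀ y z → x * y ≡ x * z → y ≡ z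
  *-cancelˡ x≢0 y z eq = begin
    y                                       ≡⟨ x⁻¹*[x*y]≡y x≢0 y ⟨
    proj₁ (inverse _ x≢0) * (_ * y)         ≡⟨ cong (proj₁ (inverse _ x≢0) *_) eq ⟩
    proj₁ (inverse _ x≢0) * (_ * z)         ≡⟨ x⁻¹*[x*y]≡y x≢0 z ⟩
    z                                       ∎

  *-nonzero : ∀ {x y} → x ≢ 0# → y ≢ 0# → x * y ≢ 0#
  *-nonzero {x} x≢0 y≢0 xy≡0 = y≢0 (*-cancelˡ x≢0 _ _ (trans xy≡0 (sym (zeroʳ x))))

  ^-nonzero : ∀ {x} → x ≢ 0# → ∀ n → x ^ n ≢ 0#
  ^-nonzero x≢0 zero    = 0≢1 ∘ sym
  ^-nonzero x≢0 (suc n) = *-nonzero x≢0 (^-nonzero x≢0 n)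

  ^≡0⇒≡0 : ∀ {x} n → x ^ n ≡ 0# → x ≡ 0#
  ^≡0⇒≡0 {x} n xⁿ≡0 with x ≟ 0#
  ... | yes x≡0 = x≡0
  ... | no x≢0  = contradiction xⁿ≡0 (^-nonzero x≢0 n)

  ^-homo-+ : ∀ x m n → x ^ (m ℕ.+ n) ≡ x ^ m * x ^ n
  ^-homo-+ x zero    n = sym (*-identityˡ _)
  ^-homo-+ x (suc m) n = trans (cong (x *_) (^-homo-+ x m n)) (sym (*-assoc x _ _))

  1^n≡1 : ∀ n → 1# ^ n ≡ 1#
  1^n≡1 zero    = refl
  1^n≡1 (suc n) = trans (*-identityˡ _) (1^n≡1 n)

  ^-* : ∀ x m n → x ^ (m ℕ.* n) ≡ (x ^ m) ^ n
  ^-* x m zero    = cong (x ^_) (ℕ.*-zeroʳ m)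
  ^-* x m (suc n) = begin
    x ^ (m ℕ.* suc n)         ≡⟨ cong (x ^_) (ℕ.*-suc m n) ⟩
    x ^ (m ℕ.+ m ℕ.* n)       ≡⟨ ^-homo-+ x m (m ℕ.* n) ⟩
    x ^ m * x ^ (m ℕ.* n)     ≡⟨ cong (x ^ m *_) (^-* x m n) ⟩
    x ^ m * (x ^ m) ^ n       ∎

  ^-periodic : ∀ {x n} → x ^ n ≡ 1# → ∀ j t → x ^ (j ℕ.+ t ℕ.* n) ≡ x ^ j
  ^-periodic {x} {n} xⁿ≡1 j t = begin
    x ^ (j ℕ.+ t ℕ.* n)        ≡⟨ ^-homo-+ x j (t ℕ.* n) ⟩
    x ^ j * x ^ (t ℕ.* n)      ≡⟨ cong (λ e → x ^ j * x ^ e) (ℕ.*-comm t n) ⟩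
    x ^ j * x ^ (n ℕ.* t)      ≡⟨ cong (x ^ j *_) (trans (^-* x n t) (trans (cong (_^ t) xⁿ≡1) (1^n≡1 t))) ⟩
    x ^ j * 1#                 ≡⟨ *-identityʳ _ ⟩
    x ^ j                      ∎

  ^-mod : ∀ {x} n .{{_ : NonZero n}} → x ^ n ≡ 1# → ∀ j → x ^ j ≡ x ^ (j % n)
  ^-mod n xⁿ≡1 j = trans (cong (_ ^_) (m≡m%n+[m/n]*n j n)) (^-periodic xⁿ≡1 (j % n) (j / n))

module Frobenius {q : ℕ} (F : FiniteField q) where
  open import Data.Nat as ℕ using (zero; suc; s≤s; z≤n)
  import Data.Nat.Properties as ℕ
  open import Data.Nat.Divisibility using (divides)
  open import Data.Nat.Primality using (Prime)
  open import Data.Nat.Combinatorics using (_C_; nCn≡1)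
  open import Data.Fin as Fin using (Fin)
  open import Data.Fin.Properties using (toℕ-fromℕ; toℕ-inject₁; toℕ<n)
  open import Data.Fin.Permutation using (permutation)
  open import Relation.Binary.PropositionalEquality
  open ≡-Reasoning
  open import Function using (_∘_)
  open FieldProperties F
  open import Algebra.Properties.CommutativeMonoid.Sum +-commutativeMonoid
    using (sum; sum-permute; ∑-distrib-+; sum-replicate; sum-init-last; sum-cong-≗; sum-replicate-zero)
  open import Algebra.Properties.Semiring.Mult semiring using (_×_; ×1-homo-*; ×-assoc-*)
  open import Algebra.Properties.Semiring.Exp semiring using () renaming (_^_ to _^ₛ_)
  import Algebra.Properties.CommutativeSemiring.Binomial commutativeSemiring as Binomial

  PowerAdditive : ℕ → Set
  PowerAdditive n = ∀ x y → (x + y) ^ n ≡ x ^ n + y ^ n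

  q×x≡0 : ∀ x → q × x ≡ 0#
  q×x≡0 x = +-identityʳ-unique (sum id) (q × x) (begin
    sum id + q × x                ≡⟨ +-comm _ _ ⟩
    q × x + sum id                ≡⟨ cong (_+ sum id) (sum-replicate q) ⟨
    sum {q} (λ _ → x) + sum id    ≡⟨ ∑-distrib-+ (λ _ → x) id ⟨
    sum (x +_)                    ≡⟨ sum-permute id translation ⟨
    sum id                        ∎)
    where
    id : Fin q → Fin q
    id y = y
    translation = permutation (x +_) (- x +_) (x+[-x+y]≡y x) (-x+[x+y]≡y x)

  p×1≡0 : ∀ {p R} → 1 ≤ R → q ≡ p ℕ.^ R → p × 1# ≡ 0#
  p×1≡0 {p} {R} (s≤s z≤n) refl = ^≡0⇒≡0 R (begin
    (p × 1#) ^ R    ≡⟨ ×1-^ R ⟨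
    (p ℕ.^ R) × 1#  ≡⟨ q×x≡0 1# ⟩
    0#              ∎)
    where
    ×1-^ : ∀ n → (p ℕ.^ n) × 1# ≡ (p × 1#) ^ n
    ×1-^ zero    = +-identityʳ 1#
    ×1-^ (suc n) = trans (×1-homo-* p (p ℕ.^ n)) (cong ((p × 1#) *_) (×1-^ n))

  ^ₛ≗^ : ∀ x n → x ^ₛ n ≡ x ^ n
  ^ₛ≗^ x zero    = refl
  ^ₛ≗^ x (suc n) = cong (x *_) (^ₛ≗^ x n)

  ×-annihilated : ∀ {p} → p × 1# ≡ 0# → ∀ c z → (c ℕ.* p) × z ≡ 0#
  ×-annihilated {p} p×1≡0 c z = begin
    (c ℕ.* p) × z               ≡⟨ cong ((c ℕ.* p) ×_) (*-identityˡ z) ⟨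
    (c ℕ.* p) × (1# * z)        ≡⟨ ×-assoc-* (c ℕ.* p) 1# z ⟨
    ((c ℕ.* p) × 1#) * z        ≡⟨ cong (_* z) (×1-homo-* c p) ⟩
    ((c × 1#) * (p × 1#)) * z   ≡⟨ cong (λ w → ((c × 1#) * w) * z) p×1≡0 ⟩
    ((c × 1#) * 0#) * z         ≡⟨ cong (_* z) (zeroʳ _) ⟩
    0# * z                      ≡⟨ zeroˡ z ⟩
    0#                          ∎

  frobenius-additive : ∀ {p} → Prime p → p × 1# ≡ 0# → PowerAdditive p
  frobenius-additive {p@(suc n)} pr p×1≡0 x y = begin
    (x + y) ^ p                                  ≡⟨ ^ₛ≗^ (x + y) p ⟨
    (x + y) ^ₛ p                                 ≡⟨ Binomial.theorem p x y ⟩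
    sum term                                     ≡⟨ cong (term Fin.zero +_) (sum-init-last (term ∘ Fin.suc)) ⟩
    term Fin.zero + (sum inner + term last)      ≡⟨ cong (λ s → term Fin.zero + (s + term last)) inner-vanishes ⟩
    term Fin.zero + (0# + term last)             ≡⟨ cong (term Fin.zero +_) (+-identityˡ _) ⟩
    term Fin.zero + term last                    ≡⟨ cong₂ _+_ first-term last-term ⟩
    y ^ p + x ^ p                                ≡⟨ +-comm _ _ ⟩
    x ^ p + y ^ p                                ∎
    where
    term = Binomial.binomialTerm x y p
    last = Fin.suc (Fin.fromℕ n)
    inner : Fin n → Fin q
    inner j = term (Fin.suc (Fin.inject₁ j))
    first-term : term Fin.zero ≡ y ^ p
    first-term = trans (+-identityʳ _) (trans (*-identityˡ _) (^ₛ≗^ y p))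
    last-term : term last ≡ x ^ p
    last-term = begin
      term last
        ≡⟨ cong (λ i → (p C i) × (x ^ₛ i * y ^ₛ (p ℕ.∸ i))) (cong suc (toℕ-fromℕ n)) ⟩
      (p C p) × (x ^ₛ p * y ^ₛ (p ℕ.∸ p))
        ≡⟨ cong₂ (λ c i → c × (x ^ₛ p * y ^ₛ i)) (nCn≡1 p) (ℕ.n∸n≡0 p) ⟩
      1 × (x ^ₛ p * 1#)                       ≡⟨ trans (+-identityʳ _) (trans (*-identityʳ _) (^ₛ≗^ x p)) ⟩
      x ^ p                                   ∎
    inner-vanishes : sum inner ≡ 0#
    inner-vanishes = trans (sum-cong-≗ vanishes) (sum-replicate-zero n)
      where
      vanishes : ∀ j → inner j ≡ 0#
      vanishes j with BinomialPrime.prime∣C pr {suc (Fin.toℕ (Fin.inject₁ j))} (s≤s z≤n)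
                        (s≤s (subst (ℕ._< n) (sym (toℕ-inject₁ j)) (toℕ<n j)))
      ... | divides c eq = trans (cong (_× monomial) eq) (×-annihilated p×1≡0 c monomial)
        where
        i = suc (Fin.toℕ (Fin.inject₁ j))
        monomial = x ^ₛ i * y ^ₛ (p ℕ.∸ i)

  powerAdditive-* : ∀ {m n} → PowerAdditive m → PowerAdditive n → PowerAdditive (m ℕ.* n)
  powerAdditive-* {m} {n} m-additive n-additive x y = begin
    (x + y) ^ (m ℕ.* n)          ≡⟨ ^-* (x + y) m n ⟩
    ((x + y) ^ m) ^ n            ≡⟨ cong (_^ n) (m-additive x y) ⟩
    (x ^ m + y ^ m) ^ n          ≡⟨ n-additive (x ^ m) (y ^ m) ⟩
    (x ^ m) ^ n + (y ^ m) ^ n    ≡⟨ cong₂ _+_ (^-* x m n) (^-* y m n) ⟨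
    x ^ (m ℕ.* n) + y ^ (m ℕ.* n) ∎

  powerAdditive-^ : ∀ {p} → PowerAdditive p → ∀ a → PowerAdditive (p ℕ.^ a)
  powerAdditive-^ p-additive zero    x y = trans (*-identityʳ _) (sym (cong₂ _+_ (*-identityʳ x) (*-identityʳ y)))
  powerAdditive-^ {p} p-additive (suc a) = powerAdditive-* {p} {p ℕ.^ a} p-additive (powerAdditive-^ p-additive a)

module PrimitiveElement {N : ℕ} (F : FiniteField (suc N)) (ω : Fin (suc N))
                        (isPrimitive : FiniteField.IsPrimitive F ω) (N≥2 : 2 ≤ N) where
  open import Data.Nat as ℕ using (zero; suc; NonZero; _≤_; _<_; s≤s; z≤n)
  open import Data.Nat.Properties as ℕ
    using ( ≤-antisym; ≤-trans; ≤-<-trans; <-≤-trans; m∸n≤m; m+[n∸m]≡n; m<n⇒0<n∸m; <⇒≤; <⇒≱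
          ; m≤n⇒m<n∨m≡n; n<1+n; *-cancelʳ-≡; *-monoˡ-<)
  open import Data.Nat.DivMod using (_%_; _/_; m%n<n; m≡m%n+[m/n]*n)
  open import Data.Nat.Divisibility using (_∣_; divides)
  open import Data.Fin as Fin using (punchIn; punchOut; toℕ; fromℕ<)
  open import Data.Fin.Properties
    using (punchIn-injective; punchInᵢ≢i; punchOut-injective; pigeonhole; injective⇒≤; toℕ-fromℕ<; toℕ<n; toℕ-injective)
  open import Data.Product using (∃-syntax; _,_; proj₁; proj₂)
  open import Data.Sum using (inj₁; inj₂)
  open import Function using (_∘_)
  open import Function.Definitions using (Injective)
  open import Data.Nat.Tactic.RingSolver using (solve-∀)
  open import Data.Empty using (⊥)
  open import Relation.Nullary using (contradiction)
  open import Relation.Binary.PropositionalEquality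
  open ≡-Reasoning
  open FieldProperties F
  open GraphDegree using (HasDegree)

  instance
    N-nonZero : NonZero N
    N-nonZero = ℕ.>-nonZero (<-≤-trans (s≤s z≤n) N≥2)

  log : ∀ x → x ≢ 0# → ℕ
  log x x≢0 = proj₁ (isPrimitive x x≢0)

  ω^log : ∀ x (x≢0 : x ≢ 0#) → ω ^ log x x≢0 ≡ x
  ω^log x x≢0 = sym (proj₂ (isPrimitive x x≢0))

  -- For N = 1, ω = 0 would satisfy IsPrimitive because 1# ≡ 0# ^ 0; this is where N ≥ 2 is needed.
  ω≢0 : ω ≢ 0#
  ω≢0 ω≡0 = two-distinct-units N≥2
    where
    nonzero-is-1 : ∀ i → punchIn 0# i ≡ 1#
    nonzero-is-1 i with isPrimitive (punchIn 0# i) (punchInᵢ≢i 0# i)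
    ... | zero  , x≡1   = x≡1
    ... | suc j , x≡ωω^j = contradiction (trans x≡ωω^j (trans (cong (_* (ω ^ j)) ω≡0) (zeroˡ _))) (punchInᵢ≢i 0# i)
    two-distinct-units : 2 ≤ N → ⊥
    two-distinct-units (s≤s (s≤s _))
      with () ← punchIn-injective 0# Fin.zero (Fin.suc Fin.zero) (trans (nonzero-is-1 _) (sym (nonzero-is-1 _)))

  ω^-nonzero : ∀ n → ω ^ n ≢ 0#
  ω^-nonzero = ^-nonzero ω≢0

  ω^≡1⇒N≤ : ∀ {n} → 0 < n → ω ^ n ≡ 1# → N ≤ n
  ω^≡1⇒N≤ {n@(suc _)} _ ωⁿ≡1 = injective⇒≤ {f = log-mod-n} log-mod-n-injective
    where
    log-nonzero : Fin N → ℕ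
    log-nonzero i = log (punchIn 0# i) (punchInᵢ≢i 0# i)
    log-mod-n : Fin N → Fin n
    log-mod-n i = fromℕ< (m%n<n (log-nonzero i) n)
    ω^log-mod-n : ∀ i → ω ^ toℕ (log-mod-n i) ≡ punchIn 0# i
    ω^log-mod-n i = begin
      ω ^ toℕ (log-mod-n i)      ≡⟨ cong (ω ^_) (toℕ-fromℕ< (m%n<n (log-nonzero i) n)) ⟩
      ω ^ (log-nonzero i % n)    ≡⟨ ^-mod n ωⁿ≡1 (log-nonzero i) ⟨
      ω ^ log-nonzero i          ≡⟨ ω^log _ _ ⟩
      punchIn 0# i               ∎
    log-mod-n-injective : Injective _≡_ _≡_ log-mod-n
    log-mod-n-injective {i} {j} eq = punchIn-injective 0# i j (begin
      punchIn 0# i                 ≡⟨ ω^log-mod-n i ⟨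
      ω ^ toℕ (log-mod-n i)        ≡⟨ cong (λ k → ω ^ toℕ k) eq ⟩
      ω ^ toℕ (log-mod-n j)        ≡⟨ ω^log-mod-n j ⟩
      punchIn 0# j                 ∎)

  ω^-cancel : ∀ {i j} → i ≤ j → ω ^ i ≡ ω ^ j → ω ^ (j ℕ.∸ i) ≡ 1#
  ω^-cancel {i} {j} i≤j eq = sym (*-cancelˡ (ω^-nonzero i) 1# (ω ^ (j ℕ.∸ i)) (begin
    ω ^ i * 1#              ≡⟨ *-identityʳ _ ⟩
    ω ^ i                   ≡⟨ eq ⟩
    ω ^ j                   ≡⟨ cong (ω ^_) (m+[n∸m]≡n i≤j) ⟨
    ω ^ (i ℕ.+ (j ℕ.∸ i))   ≡⟨ ^-homo-+ ω i _ ⟩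
    ω ^ i * ω ^ (j ℕ.∸ i)   ∎))

  -- Pigeonhole on ω ^ 0, …, ω ^ N among the N nonzero elements.
  ω^N≡1 : ω ^ N ≡ 1#
  ω^N≡1 with i , j , i<j , eq ← pigeonhole (n<1+n N) (λ i → punchOut (ω^-nonzero (toℕ i) ∘ sym))
    = subst (λ n → ω ^ n ≡ 1#) j-i≡N ω^[j-i]≡1
    where
    ω^[j-i]≡1 : ω ^ (toℕ j ℕ.∸ toℕ i) ≡ 1#
    ω^[j-i]≡1 = ω^-cancel (<⇒≤ i<j) (punchOut-injective (ω^-nonzero (toℕ i) ∘ sym) (ω^-nonzero (toℕ j) ∘ sym) eq)
    j-i≡N : toℕ j ℕ.∸ toℕ i ≡ N
    j-i≡N = ≤-antisym (≤-trans (m∸n≤m (toℕ j) (toℕ i)) (ℕ.≤-pred (toℕ<n j)))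
                      (ω^≡1⇒N≤ (m<n⇒0<n∸m i<j) ω^[j-i]≡1)

  ω^-injective-≤ : ∀ {i j} → i ≤ j → j < N → ω ^ i ≡ ω ^ j → i ≡ j
  ω^-injective-≤ {i} {j} i≤j j<N eq with m≤n⇒m<n∨m≡n i≤j
  ... | inj₂ i≡j = i≡j
  ... | inj₁ i<j = contradiction (ω^≡1⇒N≤ (m<n⇒0<n∸m i<j) (ω^-cancel i≤j eq)) (<⇒≱ (≤-<-trans (m∸n≤m j i) j<N))

  ω^-injective : ∀ {i j} → i < N → j < N → ω ^ i ≡ ω ^ j → i ≡ j
  ω^-injective {i} {j} i<N j<N eq with ℕ.≤-total i j
  ... | inj₁ i≤j = ω^-injective-≤ i≤j j<N eq
  ... | inj₂ j≤i = sym (ω^-injective-≤ j≤i i<N (sym eq))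

  ω^-periodic : ∀ i t → ω ^ (i ℕ.+ t ℕ.* N) ≡ ω ^ i
  ω^-periodic = ^-periodic ω^N≡1

  ω^≡1⇒N∣ : ∀ {n} → ω ^ n ≡ 1# → N ∣ n
  ω^≡1⇒N∣ {n} ωⁿ≡1 = divides (n ℕ./ N) (trans (m≡m%n+[m/n]*n n N) (cong (ℕ._+ (n ℕ./ N) ℕ.* N) n%N≡0))
    where
    n%N≡0 : n % N ≡ 0
    n%N≡0 = ω^-injective (m%n<n n N) (<-≤-trans (s≤s z≤n) N≥2) (trans (sym (^-mod N ω^N≡1 n)) ωⁿ≡1)

  gPaley-hasDegree : ∀ {k d} → d ℕ.* k ≡ N → HasDegree (GPaleyAdj F ω k) 0# d
  gPaley-hasDegree {k} {d} d*k≡N = record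
    { neighbour           = λ j → ω ^ (toℕ j ℕ.* k)
    ; neighbour-adjacent  = λ j → toℕ j , x-0≡x _
    ; neighbour-injective = λ {i} {j} eq → toℕ-injective (*-cancelʳ-≡ _ _ k (ω^-injective (bound i) (bound j) eq))
    ; neighbour-complete  = complete
    }
    where
    instance
      d*k-nonZero : NonZero (d ℕ.* k)
      d*k-nonZero = subst NonZero (sym d*k≡N) N-nonZero
      d-nonZero : NonZero d
      d-nonZero = ℕ.m*n≢0⇒m≢0 d
      k-nonZero : NonZero k
      k-nonZero = ℕ.m*n≢0⇒n≢0 d
    bound : ∀ (j : Fin d) → toℕ j ℕ.* k < N
    bound j = subst (toℕ j ℕ.* k <_) d*k≡N (*-monoˡ-< k (toℕ<n j))
    complete : ∀ v → GPaleyAdj F ω k 0# v → ∃[ j ] ω ^ (toℕ j ℕ.* k) ≡ v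
    complete v (J , v-0≡ω^Jk) = fromℕ< J%d<d , (begin
      ω ^ (toℕ (fromℕ< J%d<d) ℕ.* k)            ≡⟨ cong (λ i → ω ^ (i ℕ.* k)) (toℕ-fromℕ< J%d<d) ⟩
      ω ^ (J % d ℕ.* k)                         ≡⟨ ω^-periodic (J % d ℕ.* k) (J / d) ⟨
      ω ^ (J % d ℕ.* k ℕ.+ J / d ℕ.* N)         ≡⟨ cong (λ n → ω ^ (J % d ℕ.* k ℕ.+ J / d ℕ.* n)) d*k≡N ⟨
      ω ^ (J % d ℕ.* k ℕ.+ J / d ℕ.* (d ℕ.* k)) ≡⟨ cong (ω ^_) (regroup (J % d) (J / d) d k) ⟩
      ω ^ ((J % d ℕ.+ J / d ℕ.* d) ℕ.* k)       ≡⟨ cong (λ i → ω ^ (i ℕ.* k)) (m≡m%n+[m/n]*n J d) ⟨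
      ω ^ (J ℕ.* k)                             ≡⟨ v-0≡ω^Jk ⟨
      v - 0#                                    ≡⟨ x-0≡x v ⟩
      v                                         ∎)
      where
      J%d<d = m%n<n J d
      regroup : ∀ r t d k → r ℕ.* k ℕ.+ t ℕ.* (d ℕ.* k) ≡ (r ℕ.+ t ℕ.* d) ℕ.* k
      regroup = solve-∀

module SubfieldCoordinates
  {k b m₁ : ℕ}
  (F : FiniteField (suc (k ℕ.* b ℕ.* m₁))) (ω : Fin (suc (k ℕ.* b ℕ.* m₁)))
  (isPrimitive : FiniteField.IsPrimitive F ω) (N≥2 : 2 ≤ k ℕ.* b ℕ.* m₁)
  (m-additive : Frobenius.PowerAdditive F (suc m₁))
  (card : suc m₁ ℕ.^ b ≡ suc (k ℕ.* b ℕ.* m₁))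
  (connected : Connected (GPaleyAdj F ω k))
  where
  open import Data.Nat as ℕ using (zero; suc; _<_)
  open import Data.Nat.Properties as ℕ using (*-cancelˡ-≡; *-monoʳ-<)
  open import Data.Nat.DivMod using (_%_; _/_; m%n<n; m≡m%n+[m/n]*n)
  open import Data.Nat.Divisibility using (_∣_; *-cancelʳ-∣; quotient)
  open import Data.Nat.Tactic.RingSolver using (solve-∀)
  open import Data.Fin as Fin using (toℕ; fromℕ<)
  open import Data.Fin.Properties using (_≟_; toℕ-fromℕ<; toℕ<n; toℕ-injective)
  open import Data.Product using (∃-syntax; _×_; _,_; proj₁; proj₂)
  open import Data.Vec using (Vec; []; _∷_; lookup; replicate; _[_]≔_)
  open import Function using (_∘_)
  open import Relation.Nullary using (yes; no; contradiction)
  open import Relation.Binary.PropositionalEquality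
  open ≡-Reasoning
  open FieldProperties F
  open PrimitiveElement F ω isPrimitive N≥2
  open FinCounting using (cast-injective; vecToFin-injective; section-of-surjection-is-inverse)
  open HammingGraph using (update-hammingAdj; hammingAdj⇒update)
  open import Function.Bundles using (Bijection)

  m = suc m₁
  c = k ℕ.* b
  N = c ℕ.* m₁

  instance
    c-nonZero : ℕ.NonZero c
    c-nonZero = ℕ.m*n≢0⇒m≢0 c
    b-nonZero : ℕ.NonZero b
    b-nonZero = ℕ.m*n≢0⇒n≢0 k
    m₁-nonZero : ℕ.NonZero m₁
    m₁-nonZero = ℕ.m*n≢0⇒n≢0 c

  InSubfield : Fin (suc N) → Set
  InSubfield y = y ^ m ≡ y

  0#∈ : InSubfield 0#
  0#∈ = zeroˡ _

  ω^c*∈ : ∀ l → InSubfield (ω ^ (c ℕ.* l))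
  ω^c*∈ l = begin
    (ω ^ (c ℕ.* l)) ^ m           ≡⟨ ^-* ω (c ℕ.* l) m ⟨
    ω ^ (c ℕ.* l ℕ.* m)           ≡⟨ cong (ω ^_) (expand c l m₁) ⟩
    ω ^ (c ℕ.* l ℕ.+ l ℕ.* N)     ≡⟨ ω^-periodic (c ℕ.* l) l ⟩
    ω ^ (c ℕ.* l)                 ∎
    where
    expand : ∀ c l m₁ → c ℕ.* l ℕ.* suc m₁ ≡ c ℕ.* l ℕ.+ l ℕ.* (c ℕ.* m₁)
    expand = solve-∀

  +-∈ : ∀ {x y} → InSubfield x → InSubfield y → InSubfield (x + y)
  +-∈ {x} {y} x∈ y∈ = trans (m-additive x y) (cong₂ _+_ x∈ y∈)

  -‿∈ : ∀ {x} → InSubfield x → InSubfield (- x)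
  -‿∈ {x} x∈ = +-cancelˡ x _ _ (begin
    x + (- x) ^ m          ≡⟨ cong (_+ (- x) ^ m) x∈ ⟨
    x ^ m + (- x) ^ m      ≡⟨ m-additive x (- x) ⟨
    (x - x) ^ m            ≡⟨ cong (_^ m) (-‿inverseʳ x) ⟩
    0# ^ m                 ≡⟨ 0#∈ ⟩
    0#                     ≡⟨ -‿inverseʳ x ⟨
    x - x                  ∎)

  -- y ^ m ≡ y with y ≢ 0 gives ω ^ (log y * m₁) ≡ 1, so N = c * m₁ divides log y * m₁.
  nonzero-∈⇒ω^c* : ∀ {y} → InSubfield y → y ≢ 0# → ∃[ l ] y ≡ ω ^ (c ℕ.* l)
  nonzero-∈⇒ω^c* {y} y∈ y≢0 =
    quotient c∣log , trans (sym (ω^log y y≢0)) (cong (ω ^_) (trans (_∣_.equality c∣log) (ℕ.*-comm _ c)))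
    where
    y^m₁≡1 : y ^ m₁ ≡ 1#
    y^m₁≡1 = sym (*-cancelˡ y≢0 1# (y ^ m₁) (trans (*-identityʳ y) (sym y∈)))
    c∣log : c ∣ log y y≢0
    c∣log = *-cancelʳ-∣ m₁ (ω^≡1⇒N∣ (begin
      ω ^ (log y y≢0 ℕ.* m₁)     ≡⟨ ^-* ω (log y y≢0) m₁ ⟩
      (ω ^ log y y≢0) ^ m₁       ≡⟨ cong (_^ m₁) (ω^log y y≢0) ⟩
      y ^ m₁                     ≡⟨ y^m₁≡1 ⟩
      1#                         ∎))

  embed : Fin m → Fin (suc N)
  embed Fin.zero    = 0#
  embed (Fin.suc j) = ω ^ (c ℕ.* toℕ j)

  embed-∈ : ∀ j → InSubfield (embed j)
  embed-∈ Fin.zero    = 0#∈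
  embed-∈ (Fin.suc j) = ω^c*∈ (toℕ j)

  embed-surjective : ∀ {y} → InSubfield y → ∃[ j ] embed j ≡ y
  embed-surjective {y} y∈ with y ≟ 0#
  ... | yes y≡0 = Fin.zero , sym y≡0
  ... | no y≢0 with l , y≡ω^cl ← nonzero-∈⇒ω^c* y∈ y≢0 = Fin.suc (fromℕ< l%m₁<m₁) , (begin
    ω ^ (c ℕ.* toℕ (fromℕ< l%m₁<m₁))           ≡⟨ cong (λ i → ω ^ (c ℕ.* i)) (toℕ-fromℕ< l%m₁<m₁) ⟩
    ω ^ (c ℕ.* (l % m₁))                       ≡⟨ ω^-periodic (c ℕ.* (l % m₁)) (l / m₁) ⟨
    ω ^ (c ℕ.* (l % m₁) ℕ.+ l / m₁ ℕ.* N)      ≡⟨ cong (ω ^_) (regroup c m₁ (l % m₁) (l / m₁)) ⟩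
    ω ^ (c ℕ.* (l % m₁ ℕ.+ l / m₁ ℕ.* m₁))     ≡⟨ cong (λ i → ω ^ (c ℕ.* i)) (m≡m%n+[m/n]*n l m₁) ⟨
    ω ^ (c ℕ.* l)                              ≡⟨ y≡ω^cl ⟨
    y                                          ∎)
    where
    l%m₁<m₁ = m%n<n l m₁
    regroup : ∀ c m₁ r t → c ℕ.* r ℕ.+ t ℕ.* (c ℕ.* m₁) ≡ c ℕ.* (r ℕ.+ t ℕ.* m₁)
    regroup = solve-∀

  embed-injective : ∀ {i j} → embed i ≡ embed j → i ≡ j
  embed-injective {Fin.zero}  {Fin.zero}  _  = refl
  embed-injective {Fin.zero}  {Fin.suc j} eq = contradiction (sym eq) (ω^-nonzero (c ℕ.* toℕ j))
  embed-injective {Fin.suc i} {Fin.zero}  eq = contradiction eq (ω^-nonzero (c ℕ.* toℕ i))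
  embed-injective {Fin.suc i} {Fin.suc j} eq =
    cong Fin.suc (toℕ-injective (*-cancelˡ-≡ _ _ c (ω^-injective (bound i) (bound j) eq)))
    where
    bound : ∀ (i : Fin m₁) → c ℕ.* toℕ i < N
    bound i = *-monoʳ-< c (toℕ<n i)

  basis : Fin b → Fin (suc N)
  basis i = ω ^ (toℕ i ℕ.* k)

  ω^c*·basis : ∀ l i → ω ^ (c ℕ.* l) * basis i ≡ ω ^ ((b ℕ.* l ℕ.+ toℕ i) ℕ.* k)
  ω^c*·basis l i = trans (sym (^-homo-+ ω (c ℕ.* l) (toℕ i ℕ.* k))) (cong (ω ^_) (regroup k b l (toℕ i)))
    where
    regroup : ∀ k b l i → k ℕ.* b ℕ.* l ℕ.+ i ℕ.* k ≡ (b ℕ.* l ℕ.+ i) ℕ.* k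
    regroup = solve-∀

  connection-coset : ∀ j → ω ^ (j ℕ.* k) ≡ ω ^ (c ℕ.* (j / b)) * basis (fromℕ< (m%n<n j b))
  connection-coset j = begin
    ω ^ (j ℕ.* k)                            ≡⟨ cong (λ n → ω ^ (n ℕ.* k)) j≡b*[j/b]+r ⟩
    ω ^ ((b ℕ.* (j / b) ℕ.+ toℕ r) ℕ.* k)    ≡⟨ ω^c*·basis (j / b) r ⟨
    ω ^ (c ℕ.* (j / b)) * basis r            ∎
    where
    r = fromℕ< (m%n<n j b)
    j≡b*[j/b]+r : j ≡ b ℕ.* (j / b) ℕ.+ toℕ r
    j≡b*[j/b]+r = trans (m≡m%n+[m/n]*n j b)
      (trans (ℕ.+-comm (j % b) _) (cong₂ ℕ._+_ (ℕ.*-comm (j / b) b) (sym (toℕ-fromℕ< (m%n<n j b)))))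

  linComb : ∀ {n} → Vec (Fin m) n → (Fin n → Fin (suc N)) → Fin (suc N)
  linComb []       σ = 0#
  linComb (x ∷ xs) σ = embed x * σ Fin.zero + linComb xs (σ ∘ Fin.suc)

  linComb-replicate-zero : ∀ {n} σ → linComb (replicate n Fin.zero) σ ≡ 0#
  linComb-replicate-zero {zero}  σ = refl
  linComb-replicate-zero {suc n} σ = trans (cong₂ _+_ (zeroˡ _) (linComb-replicate-zero (σ ∘ Fin.suc))) (+-identityˡ 0#)

  linComb-update : ∀ {n} (xs : Vec (Fin m) n) σ i y →
    linComb (xs [ i ]≔ y) σ + embed (lookup xs i) * σ i ≡ linComb xs σ + embed y * σ i
  linComb-update (x ∷ xs) σ Fin.zero    y = [x+y]+z≡[z+y]+x _ _ _
  linComb-update (x ∷ xs) σ (Fin.suc i) y =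
    trans (+-assoc _ _ _) (trans (cong (embed x * σ Fin.zero +_) (linComb-update xs (σ ∘ Fin.suc) i y)) (sym (+-assoc _ _ _)))

  Adj = GPaleyAdj F ω k

  point : Vec (Fin m) b → Fin (suc N)
  point xs = linComb xs basis

  point-update : ∀ xs i y → point (xs [ i ]≔ y) - point xs ≡ (embed y - embed (lookup xs i)) * basis i
  point-update xs i y = w+as≡u+es⇒w-u≡[e-a]s (linComb-update xs basis i y)

  neighbour-of-point : ∀ xs v → Adj (point xs) v → ∃[ i ] ∃[ y ] y ≢ lookup xs i × point (xs [ i ]≔ y) ≡ v
  neighbour-of-point xs v (j , v-u≡ω^jk) = i , y , y≢xsᵢ , +-cancelʳ (- point xs) _ _ (begin
    point (xs [ i ]≔ y) - point xs        ≡⟨ point-update xs i y ⟩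
    (embed y - xsᵢ) * basis i             ≡⟨ cong (λ e → (e - xsᵢ) * basis i) embed-y ⟩
    ((xsᵢ + t) - xsᵢ) * basis i           ≡⟨ cong (_* basis i) ([x+y]-x≡y xsᵢ t) ⟩
    t * basis i                           ≡⟨ connection-coset j ⟨
    ω ^ (j ℕ.* k)                         ≡⟨ v-u≡ω^jk ⟨
    v - point xs                          ∎)
    where
    i = fromℕ< (m%n<n j b)
    xsᵢ = embed (lookup xs i)
    t = ω ^ (c ℕ.* (j / b))
    y = proj₁ (embed-surjective (+-∈ (embed-∈ (lookup xs i)) (ω^c*∈ (j / b))))
    embed-y : embed y ≡ xsᵢ + t
    embed-y = proj₂ (embed-surjective (+-∈ (embed-∈ (lookup xs i)) (ω^c*∈ (j / b))))
    y≢xsᵢ : y ≢ lookup xs i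
    y≢xsᵢ y≡xsᵢ = ω^-nonzero (c ℕ.* (j / b)) (+-identityʳ-unique xsᵢ t (trans (sym embed-y) (cong embed y≡xsᵢ)))

  point-update-adjacent : ∀ xs i {y} → lookup xs i ≢ y → Adj (point xs) (point (xs [ i ]≔ y))
  point-update-adjacent xs i {y} xsᵢ≢y = b ℕ.* l ℕ.+ toℕ i , (begin
    point (xs [ i ]≔ y) - point xs        ≡⟨ point-update xs i y ⟩
    z * basis i                           ≡⟨ cong (_* basis i) z≡ω^cl ⟩
    ω ^ (c ℕ.* l) * basis i               ≡⟨ ω^c*·basis l i ⟩
    ω ^ ((b ℕ.* l ℕ.+ toℕ i) ℕ.* k)       ∎)
    where
    z = embed y - embed (lookup xs i)
    z∈ : InSubfield z
    z∈ = +-∈ (embed-∈ y) (-‿∈ (embed-∈ (lookup xs i)))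
    z≢0 : z ≢ 0#
    z≢0 z≡0 = xsᵢ≢y (sym (embed-injective (x∙y⁻¹≈ε⇒x≈y _ _ z≡0)))
    l = proj₁ (nonzero-∈⇒ω^c* z∈ z≢0)
    z≡ω^cl : z ≡ ω ^ (c ℕ.* l)
    z≡ω^cl = proj₂ (nonzero-∈⇒ω^c* z∈ z≢0)

  point-surjective : ∀ x → ∃[ xs ] point xs ≡ x
  point-surjective x = walk (connected 0# x) (replicate b Fin.zero , linComb-replicate-zero basis)
    where
    walk : ∀ {u w} → Reachable Adj u w → ∃[ xs ] point xs ≡ u → ∃[ xs ] point xs ≡ w
    walk here                    found      = found
    walk (step {v = v} adj rest) (xs , xs↦u) = walk rest (xs [ i ]≔ y , proj₂ (proj₂ (proj₂ next)))
      where
      next = neighbour-of-point xs v (subst (λ u → Adj u v) (sym xs↦u) adj)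
      i = proj₁ next
      y = proj₁ (proj₂ next)

  coordinates : Fin (suc N) → Vec (Fin m) b
  coordinates x = proj₁ (point-surjective x)

  point∘coordinates : ∀ x → point (coordinates x) ≡ x
  point∘coordinates x = proj₂ (point-surjective x)

  coordinates∘point : ∀ xs → coordinates (point xs) ≡ xs
  coordinates∘point = section-of-surjection-is-inverse (vecToFin-injective ∘ cast-injective card) point coordinates point∘coordinates

  coordinates-injective : ∀ {x y} → coordinates x ≡ coordinates y → x ≡ y
  coordinates-injective {x} {y} eq = begin
    x                        ≡⟨ point∘coordinates x ⟨
    point (coordinates x)    ≡⟨ cong point eq ⟩
    point (coordinates y)    ≡⟨ point∘coordinates y ⟩
    y                        ∎

  adjacent⇒hammingAdj : ∀ u v → Adj u v → HammingAdj m b (coordinates u) (coordinates v)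
  adjacent⇒hammingAdj u v adj =
    subst (HammingAdj m b (coordinates u)) coordinates-v (update-hammingAdj (coordinates u) i (y≢xsᵢ ∘ sym))
    where
    next = neighbour-of-point (coordinates u) v (subst (λ w → Adj w v) (sym (point∘coordinates u)) adj)
    i = proj₁ next
    y = proj₁ (proj₂ next)
    y≢xsᵢ : y ≢ lookup (coordinates u) i
    y≢xsᵢ = proj₁ (proj₂ (proj₂ next))
    coordinates-v : coordinates u [ i ]≔ y ≡ coordinates v
    coordinates-v = trans (sym (coordinates∘point _)) (cong coordinates (proj₂ (proj₂ (proj₂ next))))

  hammingAdj⇒adjacent : ∀ u v → HammingAdj m b (coordinates u) (coordinates v) → Adj u v
  hammingAdj⇒adjacent u v adj@(i , differs , _) =
    subst₂ Adj (point∘coordinates u) coordinates-v (point-update-adjacent (coordinates u) i differs)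
    where
    coordinates-v : point (coordinates u [ i ]≔ lookup (coordinates v) i) ≡ v
    coordinates-v = trans (cong point (sym (hammingAdj⇒update {xs = coordinates u} {ys = coordinates v} adj))) (point∘coordinates v)

  coordinates-isomorphism : Isomorphic Adj (HammingAdj m b)
  coordinates-isomorphism = bijection , λ u v → adjacent⇒hammingAdj u v , hammingAdj⇒adjacent u v
    where
    bijection : Bijection (setoid (Fin (suc N))) (setoid (Vec (Fin m) b))
    bijection = record
      { to        = coordinates
      ; cong      = cong coordinates
      ; bijective = coordinates-injective , λ xs → point xs , λ { refl → coordinates∘point xs }
      }

open import Data.Nat using (ℕ; _*_; _^_; _∸_; _≤_; _<_; _%_; _/_; NonZero)
open import Data.Nat.Properties
  using (≤-trans; ≤-<-trans; n≤1+n; *-cancelˡ-≡; *-mono-≤; ∸-monoˡ-≤; ^-*-assoc; *-comm; suc-pred; m^n>0; m^n≢0)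
open import Data.Nat.DivMod using (m/n*n≡m)
open import Data.Nat.Divisibility using (_∣_)
open import Data.Nat.Primality using (Prime; prime⇒nonTrivial; prime⇒nonZero)
open import Data.Nat.Tactic.RingSolver using (solve-∀)
open import Data.Product using (_×_; _,_)
open import Data.Fin using (Fin)
open import Function.Bundles using (_⇔_; mk⇔; Equivalence)
open import Relation.Binary.PropositionalEquality using (_≡_; refl; sym; trans; cong; subst; module ≡-Reasoning)
open Equivalence using (to; from)
open GraphDegree using (degree-unique; isomorphic⇒hasDegree)
open HammingGraph using (hamming-hasDegree)
open Frobenius using (PowerAdditive; powerAdditive-^; frobenius-additive; p×1≡0)

gPaley≅hamming⇒k*b*m₁≡N : ∀ {q N} (F : FiniteField q) ω → FiniteField.IsPrimitive F ω → q ≡ ℕ.suc N → 2 ≤ N →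
  ∀ {k m m₁ b} .{{_ : NonZero k}} → k ∣ N → m ≡ ℕ.suc m₁ →
  Isomorphic (GPaleyAdj F ω k) (HammingAdj m b) → k * b * m₁ ≡ N
gPaley≅hamming⇒k*b*m₁≡N {N = N} F ω isPrimitive refl N≥2 {k} {m₁ = m₁} {b} k∣N refl iso = begin
  k * b * m₁      ≡⟨ rearrange k b m₁ ⟩
  b * m₁ * k      ≡⟨ cong (_* k) degree≡ ⟨
  N / k * k       ≡⟨ m/n*n≡m k∣N ⟩
  N               ∎
  where
  open PrimitiveElement F ω isPrimitive N≥2 using (gPaley-hasDegree)
  open ≡-Reasoning
  degree≡ : N / k ≡ b * m₁
  degree≡ = degree-unique (isomorphic⇒hasDegree iso (gPaley-hasDegree (m/n*n≡m k∣N))) (hamming-hasDegree _)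
  rearrange : ∀ k b m₁ → k * b * m₁ ≡ b * m₁ * k
  rearrange = solve-∀

gPaley≅hamming : ∀ {q} (F : FiniteField q) ω → FiniteField.IsPrimitive F ω → ∀ {k b m m₁} →
  q ≡ ℕ.suc (k * b * m₁) → m ≡ ℕ.suc m₁ → 2 ≤ k * b * m₁ → PowerAdditive F m → m ^ b ≡ q →
  Connected (GPaleyAdj F ω k) → Isomorphic (GPaleyAdj F ω k) (HammingAdj m b)
gPaley≅hamming F ω isPrimitive {k} {b} {m₁ = m₁} refl refl N≥2 m-additive card connected =
  SubfieldCoordinates.coordinates-isomorphism {k} {b} {m₁} F ω isPrimitive N≥2 m-additive card connected

k*[R*m₁]≡a*N⇔k*b*m₁≡N : ∀ {k a b R m₁ N} .{{_ : NonZero a}} → b * a ≡ R →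
  k * (R * m₁) ≡ a * N ⇔ k * b * m₁ ≡ N
k*[R*m₁]≡a*N⇔k*b*m₁≡N {k} {a} {b} {m₁ = m₁} {N} refl =
  mk⇔ (λ eq → *-cancelˡ-≡ _ _ a (trans (rearrange k b a m₁) eq)) (λ eq → trans (sym (rearrange k b a m₁)) (cong (a *_) eq))
  where
  rearrange : ∀ k b a m₁ → a * (k * b * m₁) ≡ k * (b * a * m₁)
  rearrange = solve-∀

2≤p^n : ∀ {p n} → 2 ≤ p → 1 ≤ n → 2 ≤ p ^ n
2≤p^n {p@(ℕ.suc _)} {ℕ.suc n} 2≤p _ = *-mono-≤ 2≤p (m^n>0 p n)

4≤p^n : ∀ {p n} → 2 ≤ p → 2 ≤ n → 4 ≤ p ^ n
4≤p^n {n = ℕ.suc n} 2≤p (ℕ.s≤s 1≤n) = *-mono-≤ 2≤p (2≤p^n 2≤p 1≤n)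

theorem3p5 : (p R k : ℕ) → Prime p → 1 ≤ R → 2 ≤ k → .{{_ : NonZero k}} →
    k ∣ (p ^ R ∸ 1) →
    (p % 2 ≡ 1 → 2 ∣ ((p ^ R ∸ 1) / k)) →
    (F : FiniteField (p ^ R)) → (ω : Fin (p ^ R)) → FiniteField.IsPrimitive F ω →
    Connected (GPaleyAdj F ω k) →
    (a b : ℕ) → b * a ≡ R → 1 ≤ a → a < R →
    (Isomorphic (GPaleyAdj F ω k) (HammingAdj (p ^ a) b) → k * (R * (p ^ a ∸ 1)) ≡ a * (p ^ R ∸ 1))
    × (k * (R * (p ^ a ∸ 1)) ≡ a * (p ^ R ∸ 1) → Isomorphic (GPaleyAdj F ω k) (HammingAdj (p ^ a) b))
theorem3p5 p R k isPrime R≥1 _ k∣N _ F ω isPrimitive connected a b b*a≡R a≥1 a<R =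
  (λ iso → from equation (gPaley≅hamming⇒k*b*m₁≡N F ω isPrimitive q≡1+N N≥2 k∣N m≡1+m₁ iso)) ,
  λ eq → let k*b*m₁≡N = to equation eq in
    gPaley≅hamming F ω isPrimitive (trans q≡1+N (cong ℕ.suc (sym k*b*m₁≡N))) m≡1+m₁
      (subst (2 ≤_) (sym k*b*m₁≡N) N≥2) m-additive card connected
  where
  instance
    a-nonZero : NonZero a
    a-nonZero = ℕ.>-nonZero a≥1
    p-nonZero : NonZero p
    p-nonZero = prime⇒nonZero isPrime
  2≤p : 2 ≤ p
  2≤p = ℕ.nonTrivial⇒n>1 p {{prime⇒nonTrivial isPrime}}
  equation : k * (R * (p ^ a ∸ 1)) ≡ a * (p ^ R ∸ 1) ⇔ k * b * (p ^ a ∸ 1) ≡ p ^ R ∸ 1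
  equation = k*[R*m₁]≡a*N⇔k*b*m₁≡N {k} {a} {b} b*a≡R
  q≡1+N : p ^ R ≡ ℕ.suc (p ^ R ∸ 1)
  q≡1+N = sym (suc-pred (p ^ R) {{m^n≢0 p R}})
  m≡1+m₁ : p ^ a ≡ ℕ.suc (p ^ a ∸ 1)
  m≡1+m₁ = sym (suc-pred (p ^ a) {{m^n≢0 p a}})
  N≥2 : 2 ≤ p ^ R ∸ 1
  N≥2 = ≤-trans (n≤1+n 2) (∸-monoˡ-≤ 1 (4≤p^n 2≤p (≤-<-trans a≥1 a<R)))
  m-additive : PowerAdditive F (p ^ a)
  m-additive = powerAdditive-^ F (frobenius-additive F isPrime (p×1≡0 F R≥1 refl)) a
  card : (p ^ a) ^ b ≡ p ^ R
  card = trans (^-*-assoc p a b) (cong (p ^_) (trans (*-comm a b) b*a≡R))
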